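{- Suppose $(\mathsf P,\mathsf{Opens})$ is a semitopology and $p,p'\in\mathsf P$. Then: \begin{enumerate} \item $p$ and $p'$ are intertwined if and only if $\forall O\in\mathsf{Opens}.\ p\in O\Rightarrow p'\in\overline{O}$. \item As a corollary, $ p_{\between} = \bigcap\{\overline{O} \mid p\in O\in\mathsf{Opens}\}. $ \item Equivalently: $$ p_{\between} = \bigcap\{C\in\mathsf{Closed} \mid p\in \mathrm{interior}(C) \} = \bigcap\{C\in\mathsf{Closed} \mid C\text{ a closed neighbourhood of }p\}. $$ Thus in particular, if $C$ is a closed neighbourhood of $p$ then $p_{\between}\subseteq C$. \item $p_{\between}$ is closed and $\mathsf P\setminus p_{\between}$ is open. \end{enumerate}
   Context: A semitopology is a pair $(\mathsf P,\mathsf{Opens})$ with $\mathsf{Opens}\subseteq\mathcal P(\mathsf P)$ containing $\varnothing$ and $\mathsf P$ and closed under arbitrary unions. Points $p,p'$ are intertwined when every open neighbourhood of $p$ intersects every open neighbourhood of $p'$; $p_{\between}=\{p'\in\mathsf P\mid p,p'\text{ intertwined}\}$. The closure $\overline{X}$ of $X\subseteq\mathsf P$ is the set of points every open neighbourhood of which intersects $X$; $X$ is closed when $X=\overline X$, and $\mathsf{Closed}$ is the set of closed sets. $\mathrm{interior}(X)$ is the union of open sets contained in $X$. A closed neighbourhood of $p$ is a closed set $C$ with $p\in\mathrm{interior}(C)$. -}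

module Defs where

open import Level using (Level; 0ℓ; suc; _⊔_)
open import Data.Product using (∃; _×_; _,_)
open import Relation.Unary using (Pred; _∈_; _⊆_; _≐_; _∩_; ∅; U; Satisfiable)

-- Opens ⊆ 𝒫(P) is presented as a *set* `Opn`
-- of (codes for) open sets together with the subset ⟦ o ⟧ each denotes;
-- this keeps quantification over Opens inside Set (predicativity).
record Semitopology : Set₁ where
  field
    Point  : Set
    Opn    : Set
    ⟦_⟧    : Opn → Pred Point 0ℓ
    Opn-∅  : ∃ λ o → ⟦ o ⟧ ≐ ∅
    Opn-U  : ∃ λ o → ⟦ o ⟧ ≐ U
    Opn-⋃  : (I : Set) (f : I → Opn) → ∃ λ o → ⟦ o ⟧ ≐ (λ p → ∃ λ i → p ∈ ⟦ f i ⟧)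

module _ (S : Semitopology) where
  open Semitopology S

  IsOpen : Pred Point 0ℓ → Set
  IsOpen X = ∃ λ o → ⟦ o ⟧ ≐ X

  Intertwined : Point → Point → Set
  Intertwined p p' = ∀ (o o' : Opn) → p ∈ ⟦ o ⟧ → p' ∈ ⟦ o' ⟧ → Satisfiable (⟦ o ⟧ ∩ ⟦ o' ⟧)

  intertwinedSet : Point → Pred Point 0ℓ
  intertwinedSet p = λ p' → Intertwined p p'

  closure : Pred Point 0ℓ → Pred Point 0ℓ
  closure X = λ p → ∀ (o : Opn) → p ∈ ⟦ o ⟧ → Satisfiable (⟦ o ⟧ ∩ X)

  IsClosed : Pred Point 0ℓ → Set
  IsClosed X = X ≐ closure X

  interior : Pred Point 0ℓ → Pred Point 0ℓ
  interior X = λ p → ∃ λ (o : Opn) → ⟦ o ⟧ ⊆ X × p ∈ ⟦ o ⟧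

  ClosedNeighbourhood : Pred Point 0ℓ → Point → Set
  ClosedNeighbourhood C p = IsClosed C × p ∈ interior C

  ⋂ : ∀ {ℓ} → Pred (Pred Point 0ℓ) ℓ → Pred Point (suc 0ℓ ⊔ ℓ)
  ⋂ 𝒞 = λ x → ∀ C → C ∈ 𝒞 → x ∈ C

-- A point q fails to be intertwined with p exactly when some open neighbourhood of p misses
-- some open neighbourhood of q, i.e. when q lies outside the closure of some open
-- neighbourhood of p; so p_≬ is the intersection of those closures.  Every closed
-- neighbourhood of p contains such a closure, and each such closure is itself a closed
-- neighbourhood, so the two intersections coincide.  An intersection of closed sets is
-- closed, and classically the complement of a closed set is the union of the opens inside it.
module Submission where

open import Defs
open import Level using (0ℓ)
open import Data.Product using (∃; _×_; _,_; proj₁; proj₂; Σ)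
open import Function.Bundles using (_⇔_; mk⇔)
open import Relation.Unary using (Pred; _∈_; _⊆_; _≐_; ∁)
open import Relation.Unary.Properties using (≐-refl; ≐-trans)
open import Relation.Nullary using (yes; no)
open import Data.Empty using (⊥-elim)
open import Axiom.ExcludedMiddle using (ExcludedMiddle)

module _ (S : Semitopology) where
  open Semitopology S

  ⊆-closure : {X : Pred Point 0ℓ} → X ⊆ closure S X
  ⊆-closure x∈X o x∈o = _ , x∈o , x∈X

  closure-mono : {X Y : Pred Point 0ℓ} → X ⊆ Y → closure S X ⊆ closure S Y
  closure-mono X⊆Y q∈clX o q∈o with q∈clX o q∈o
  ... | x , x∈o , x∈X = x , x∈o , X⊆Y x∈X

  closure-isClosed : (X : Pred Point 0ℓ) → IsClosed S (closure S X)
  closure-isClosed X = ⊆-closure , λ q∈clclX o q∈o → meets-closure⇒meets o (q∈clclX o q∈o)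
    where
      meets-closure⇒meets : ∀ o → ∃ (λ y → y ∈ ⟦ o ⟧ × y ∈ closure S X) → ∃ λ x → x ∈ ⟦ o ⟧ × x ∈ X
      meets-closure⇒meets o (y , y∈o , y∈clX) = y∈clX o y∈o

  closure-least : {X C : Pred Point 0ℓ} → IsClosed S C → X ⊆ C → closure S X ⊆ C
  closure-least (_ , clC⊆C) X⊆C q∈clX = clC⊆C (closure-mono X⊆C q∈clX)

  OpensInside : Pred Point 0ℓ → Set
  OpensInside X = Σ Opn λ o → ⟦ o ⟧ ⊆ X

  interior-isOpen : (X : Pred Point 0ℓ) → IsOpen S (interior S X)
  interior-isOpen X with Opn-⋃ (OpensInside X) proj₁
  ... | u , u⊆⋃ , ⋃⊆u =
    u , (λ q∈u → from-union (u⊆⋃ q∈u)) , (λ q∈int → ⋃⊆u (to-union q∈int))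
    where
      from-union : ∀ {q} → ∃ (λ (i : OpensInside X) → q ∈ ⟦ proj₁ i ⟧) → q ∈ interior S X
      from-union ((o , o⊆X) , q∈o) = o , o⊆X , q∈o

      to-union : ∀ {q} → q ∈ interior S X → ∃ λ (i : OpensInside X) → q ∈ ⟦ proj₁ i ⟧
      to-union (o , o⊆X , q∈o) = (o , o⊆X) , q∈o

  isOpen-resp-≐ : {X Y : Pred Point 0ℓ} → X ≐ Y → IsOpen S X → IsOpen S Y
  isOpen-resp-≐ X≐Y (o , o≐X) = o , ≐-trans o≐X X≐Y

  -- Excluded middle turns q ∉ closure X into an open neighbourhood of q disjoint from X.
  isClosed⇒∁-isOpen : ExcludedMiddle 0ℓ → {X : Pred Point 0ℓ} →
                      IsClosed S X → IsOpen S (∁ X)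
  isClosed⇒∁-isOpen em {X} (_ , clX⊆X) =
    isOpen-resp-≐ (interior⊆ , ∁X⊆interior) (interior-isOpen (∁ X))
    where
      interior⊆ : interior S (∁ X) ⊆ ∁ X
      interior⊆ (o , o⊆∁X , q∈o) = o⊆∁X q∈o

      ∁X⊆interior : ∁ X ⊆ interior S (∁ X)
      ∁X⊆interior {q} q∉X with em {q ∈ interior S (∁ X)}
      ... | yes q∈int = q∈int
      ... | no q∉int = ⊥-elim (q∉X (clX⊆X meets))
        where
          meets : q ∈ closure S X
          meets o q∈o with em {∃ λ x → x ∈ ⟦ o ⟧ × x ∈ X}
          ... | yes o∩X = o∩X
          ... | no o∩X-empty = ⊥-elim (q∉int (o , (λ x∈o x∈X → o∩X-empty (_ , x∈o , x∈X)) , q∈o))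

  ⋂-antitone : ∀ {a b} {𝒜 : Pred (Pred Point 0ℓ) a} {ℬ : Pred (Pred Point 0ℓ) b} →
               (∀ B → B ∈ ℬ → ∃ λ A → A ∈ 𝒜 × A ⊆ B) → ⋂ S 𝒜 ⊆ ⋂ S ℬ
  ⋂-antitone refines x∈⋂𝒜 B B∈ℬ with refines B B∈ℬ
  ... | A , A∈𝒜 , A⊆B = A⊆B (x∈⋂𝒜 A A∈𝒜)

  module _ (p : Point) where

    intertwined⇒∈closure : ∀ {q} → Intertwined S p q → ∀ o → p ∈ ⟦ o ⟧ → q ∈ closure S ⟦ o ⟧
    intertwined⇒∈closure p≬q o p∈o o' q∈o' with p≬q o o' p∈o q∈o'
    ... | x , x∈o , x∈o' = x , x∈o' , x∈o

    ∈closures⇒intertwined : ∀ {q} → (∀ o → p ∈ ⟦ o ⟧ → q ∈ closure S ⟦ o ⟧) → Intertwined S p q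
    ∈closures⇒intertwined q∈cl o o' p∈o q∈o' with q∈cl o p∈o o' q∈o'
    ... | x , x∈o' , x∈o = x , x∈o , x∈o'

    intertwined⇔∈closures : ∀ q → Intertwined S p q ⇔ (∀ o → p ∈ ⟦ o ⟧ → q ∈ closure S ⟦ o ⟧)
    intertwined⇔∈closures q = mk⇔ intertwined⇒∈closure ∈closures⇒intertwined

    intertwinedSet≐⋂closures :
      intertwinedSet S p ≐ ⋂ S (λ X → ∃ λ o → p ∈ ⟦ o ⟧ × X ≐ closure S ⟦ o ⟧)
    intertwinedSet≐⋂closures =
        (λ p≬q X (o , p∈o , X≐clo) → proj₂ X≐clo (intertwined⇒∈closure p≬q o p∈o))
      , (λ q∈⋂ → ∈closures⇒intertwined λ o p∈o →
                   q∈⋂ (closure S ⟦ o ⟧) (o , p∈o , ≐-refl))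

    closure-isClosedNeighbourhood : ∀ {o} → p ∈ ⟦ o ⟧ → ClosedNeighbourhood S (closure S ⟦ o ⟧) p
    closure-isClosedNeighbourhood {o} p∈o = closure-isClosed ⟦ o ⟧ , o , ⊆-closure , p∈o

    intertwinedSet≐⋂closedNeighbourhoods :
      intertwinedSet S p ≐ ⋂ S (λ C → ClosedNeighbourhood S C p)
    intertwinedSet≐⋂closedNeighbourhoods =
        (λ p≬q → ⋂-antitone closure-inside (proj₁ intertwinedSet≐⋂closures p≬q))
      , (λ q∈⋂ → proj₂ intertwinedSet≐⋂closures (⋂-antitone closedNbhd-inside q∈⋂))
      where
        closure-inside : ∀ C → ClosedNeighbourhood S C p →
                         ∃ λ X → (∃ λ o → p ∈ ⟦ o ⟧ × X ≐ closure S ⟦ o ⟧) × X ⊆ C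
        closure-inside C (C-closed , o , o⊆C , p∈o) =
          closure S ⟦ o ⟧ , (o , p∈o , ≐-refl) , closure-least C-closed o⊆C

        closedNbhd-inside : ∀ X → (∃ λ o → p ∈ ⟦ o ⟧ × X ≐ closure S ⟦ o ⟧) →
                            ∃ λ C → ClosedNeighbourhood S C p × C ⊆ X
        closedNbhd-inside X (o , p∈o , _ , clo⊆X) =
          closure S ⟦ o ⟧ , closure-isClosedNeighbourhood p∈o , clo⊆X

    intertwinedSet⊆closedNeighbourhood : ∀ C → ClosedNeighbourhood S C p → intertwinedSet S p ⊆ C
    intertwinedSet⊆closedNeighbourhood C C-nbhd p≬q =
      proj₁ intertwinedSet≐⋂closedNeighbourhoods p≬q C C-nbhd

    intertwinedSet-isClosed : IsClosed S (intertwinedSet S p)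
    intertwinedSet-isClosed =
        ⊆-closure
      , λ q∈cl → ∈closures⇒intertwined λ o p∈o →
          closure-least (closure-isClosed ⟦ o ⟧) (λ p≬x → intertwined⇒∈closure p≬x o p∈o) q∈cl

open Semitopology using (Point; Opn; ⟦_⟧)

proposition5p21 : (S : Semitopology) → (p p' : Point S) →
    (Intertwined S p p' ⇔ (∀ (o : Opn S) → p ∈ ⟦ S ⟧ o → p' ∈ closure S (⟦ S ⟧ o)))
    × (intertwinedSet S p ≐ ⋂ S (λ X → ∃ λ (o : Opn S) → p ∈ ⟦ S ⟧ o × X ≐ closure S (⟦ S ⟧ o)))
    × (intertwinedSet S p ≐ ⋂ S (λ C → IsClosed S C × p ∈ interior S C))
    × (intertwinedSet S p ≐ ⋂ S (λ C → ClosedNeighbourhood S C p))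
    × (∀ C → ClosedNeighbourhood S C p → intertwinedSet S p ⊆ C)
    × IsClosed S (intertwinedSet S p)
    × (ExcludedMiddle 0ℓ → IsOpen S (∁ (intertwinedSet S p)))
proposition5p21 S p p' =
    intertwined⇔∈closures S p p'
  , intertwinedSet≐⋂closures S p
  , intertwinedSet≐⋂closedNeighbourhoods S p
  , intertwinedSet≐⋂closedNeighbourhoods S p
  , intertwinedSet⊆closedNeighbourhood S p
  , intertwinedSet-isClosed S p
  , (λ em → isClosed⇒∁-isOpen S em (intertwinedSet-isClosed S p))
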